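{- Let $d\in\mathbb{N}$, let $n$ be such that $(n,d)$-Steiner systems exist, and let $S$ be an $(n,d)$-Steiner system chosen uniformly at random from all $(n,d)$-Steiner systems on $[n]$. There exists $C_d\in(0,\infty)$ (depending only on $d$) such that for any two distinct $d$-element subsets $\sigma,\sigma'\subseteq[n]$ and every $v\in[n]\setminus(\sigma\cup\sigma')$, \[ \mathbb{P}\big(\{v\}\cup\sigma\in S\ \text{and}\ \{v\}\cup\sigma'\in S\big)\le\frac{C_d}{n^2}. \]
   Context: An $(n,d)$-Steiner system is a collection $S$ of $(d+1)$-element subsets of $[n]$ such that every $d$-element subset of $[n]$ is contained in exactly one element of $S$. -}

module Defs where

open import Data.Nat using (ℕ; zero; suc; _≡ᵇ_)
open import Data.Bool using (Bool; true; false; _∧_; if_then_else_)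
open import Data.Bool.Properties using () renaming (_≟_ to _≟ᵇ_)
open import Data.List using (List; []; _∷_; _++_; map; concatMap; filterᵇ; length)
open import Data.Vec using ([]; _∷_)
open import Data.Vec.Properties using (≡-dec)
open import Data.Fin using (Fin)
open import Data.Fin.Subset using (Subset; ∣_∣; _∪_; ⁅_⁆)
open import Data.Fin.Subset.Properties using (_⊆?_)
open import Relation.Nullary.Decidable using (⌊_⌋; does)
open import Relation.Binary.PropositionalEquality using (_≡_)

allᵇ : ∀ {A : Set} → (A → Bool) → List A → Bool
allᵇ p []       = true
allᵇ p (x ∷ xs) = p x ∧ allᵇ p xs

_≟ˢ_ : ∀ {n} (A B : Subset n) → Relation.Nullary.Decidable.Dec (A ≡ B)
_≟ˢ_ = ≡-dec _≟ᵇ_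

allSubsets : (n : ℕ) → List (Subset n)
allSubsets zero    = [] ∷ []
allSubsets (suc n) = map (false ∷_) (allSubsets n) ++ map (true ∷_) (allSubsets n)

Family : ℕ → Set
Family n = Subset n → Bool

insert : ∀ {n} → Subset n → Family n → Family n
insert A F B = if does (B ≟ˢ A) then true else F B

familiesOver : ∀ {n} → List (Subset n) → List (Family n)
familiesOver []       = (λ _ → false) ∷ []
familiesOver (A ∷ As) = concatMap (λ F → F ∷ insert A F ∷ []) (familiesOver As)

allFamilies : (n : ℕ) → List (Family n)
allFamilies n = familiesOver (allSubsets n)

#containing : ∀ {n} → Family n → Subset n → ℕ
#containing {n} F τ = length (filterᵇ (λ B → F B ∧ ⌊ τ ⊆? B ⌋) (allSubsets n))

isSteiner : (n d : ℕ) → Family n → Bool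
isSteiner n d F =
  allᵇ (λ B → if F B then ∣ B ∣ ≡ᵇ suc d else true) (allSubsets n)
  ∧ allᵇ (λ τ → if ∣ τ ∣ ≡ᵇ d then #containing F τ ≡ᵇ 1 else true) (allSubsets n)

#Steiner : (n d : ℕ) → ℕ
#Steiner n d = length (filterᵇ (λ F → isSteiner n d F) (allFamilies n))

#SteinerBoth : (n d : ℕ) → Subset n → Subset n → ℕ
#SteinerBoth n d A B =
  length (filterᵇ (λ F → isSteiner n d F ∧ F A ∧ F B) (allFamilies n))

module Submission where

-- Everything is a count over the explicit list allFamilies n, and the proof is a
-- switching (double counting) argument driven by transpositions of [n]:
--  * relabelling the points along an involution maps Steiner systems to Steiner
--    systems injectively, so a block B lies in at most as many systems as its image;
--  * for b ∈ B and points x outside B, the blocks B with b replaced by x all contain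
--    the d-set B - b, so a Steiner system contains at most one of them.
-- Hence |X| · #{S ∋ B} ≤ #S for a set X of points outside B, even among the systems
-- passing an extra test P that the transpositions (b x) preserve (lemma switching).
-- With P = "A ∈ S" and X = points outside A ∪ B, and with P = true and X = points
-- outside A, this gives (n-2d-2) · #{S ∋ A, B} ≤ #{S ∋ A} and (n-d-1) · #{S ∋ A} ≤ #S,
-- and the bound follows by arithmetic.

open import Defs
open import Data.Nat using (ℕ; _*_; _^_; _≤_; _<_)
open import Data.Product using (Σ; _×_)
open import Data.Fin using (Fin)
open import Data.Fin.Subset using (Subset; ∣_∣; _∪_; ⁅_⁆; _∉_)
open import Relation.Binary.PropositionalEquality using (_≡_; _≢_)

open import Algebra.Definitions using (Involutive)
open import Data.Bool using (Bool; true; false; T; _∧_; if_then_else_)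
open import Data.Bool.Properties using (T-∧; T-≡; ∧-identityʳ)
open import Data.Empty using (⊥-elim)
open import Data.Fin using (zero; suc; _≟_)
open import Data.Fin.Permutation.Components using (transpose)
open import Data.Fin.Properties using (any?)
open import Data.Fin.Subset using (_∈_; _⊆_; _-_; ∁; Nonempty)
open import Data.Fin.Subset.Properties
  using (_⊆?_; _∈?_; ⊆-antisym; p─q⊆p; p─⊥≡p; ∪-identityˡ; nonempty?; Empty-unique; ∣⊥∣≡0;
         p⊂q⇒∣p∣<∣q∣; p⊆p∪q; q⊆p∪q; x∈p∪q⁻; x∈⁅y⁆⇒x≡y; x∈∁p⇒x∉p; ∣∁p∣≡n∸∣p∣)
open import Data.List using (List; []; _∷_; map; filterᵇ; length; tabulate; allFin; concatMap)
open import Data.List.Properties using (length-map; length-removeAt′; map-cong)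
open import Data.List.Membership.Propositional using () renaming (_∈_ to _∈ₚ_; _∉_ to _∉ₚ_)
open import Data.List.Membership.Propositional.Properties
  using (∈-++⁺ˡ; ∈-++⁺ʳ; ∈-map⁺; ∈-map⁻; ∈-allFin)
import Data.List.Membership.Setoid as SetoidMembership
import Data.List.Membership.Setoid.Properties as SetoidMembershipₚ
open import Data.List.Relation.Binary.Disjoint.Propositional using (Disjoint)
open import Data.List.Relation.Binary.Sublist.Propositional using (⊆-refl)
open import Data.List.Relation.Binary.Sublist.Propositional.Properties using (filter⁺; length-mono-≤)
open import Data.List.Relation.Unary.All as All using (All; []; _∷_)
import Data.List.Relation.Unary.All.Properties as All
open import Data.List.Relation.Unary.All.Properties using (all-filter)
open import Data.List.Relation.Unary.AllPairs using ([]; _∷_)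
open import Data.List.Relation.Unary.Any as Any using (Any; here; there; index; _─_)
open import Data.List.Relation.Unary.Unique.Propositional using () renaming (Unique to Uniqueₚ)
open import Data.List.Relation.Unary.Unique.Propositional.Properties
  using (++⁺; map⁺; allFin⁺; Unique[x∷xs]⇒x∉xs) renaming (filter⁺ to Uniqueₚ-filter⁺)
import Data.List.Relation.Unary.Unique.Setoid as SetoidUnique
import Data.List.Relation.Unary.Unique.Setoid.Properties as SetoidUniqueₚ
open import Data.Nat using (zero; suc; _+_; _∸_; z≤n; s≤s; _≤?_)
open import Data.Nat.ListAction using (sum)
open import Data.Nat.Properties
  using (≤-antisym; ≤-reflexive; ≤-trans; <-irrefl; <⇒≤; ≰⇒>; suc-injective; ≡ᵇ⇒≡; ≡⇒≡ᵇ;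
         +-suc; +-mono-≤; +-monoˡ-≤; +-monoʳ-≤; +-cancelˡ-≤; *-mono-≤; *-monoˡ-≤; *-monoʳ-≤;
         ∸-monoʳ-≤; n≤1+n; m≤m+n; m+[n∸m]≡n; +-commutativeSemigroup; module ≤-Reasoning)
open import Algebra.Properties.CommutativeSemigroup +-commutativeSemigroup using (interchange)
open import Data.Nat.Solver using (module +-*-Solver)
open import Data.Product using (∃; _,_; proj₁; proj₂)
open import Data.Sum using (inj₁; inj₂)
open import Data.Vec using (lookup; _∷_; [])
import Data.Vec as Vec
open import Data.Vec.Properties using (∷-injectiveʳ; lookup∘tabulate; []=⇒lookup; lookup⇒[]=)
open import Function using (_∘_; id)
open import Function.Bundles using (Equivalence; mk⇔)
open import Level using (0ℓ)
open import Relation.Binary.Bundles using (Setoid)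
open import Relation.Binary.PropositionalEquality
  using (_→-setoid_; setoid; refl; sym; trans; cong; cong₂; subst; subst₂; module ≡-Reasoning)
open import Relation.Nullary using (¬_; Dec; yes; no)
open import Relation.Nullary.Decidable
  using (_×-dec_; ¬?; T?; fromWitness; ⌊_⌋; isYes≗does; does-⇔; dec-true; dec-false)

T-∧⁺ : ∀ {a b} → T a → T b → T (a ∧ b)
T-∧⁺ ta tb = Equivalence.from T-∧ (ta , tb)

T-∧⁻ : ∀ {a b} → T (a ∧ b) → T a × T b
T-∧⁻ = Equivalence.to T-∧

count : ∀ {A : Set} → (A → Bool) → List A → ℕ
count p xs = length (filterᵇ p xs)

indicator : Bool → ℕ
indicator true  = 1
indicator false = 0

module _ {A : Set} where

  count-∷ : (p : A → Bool) (x : A) (xs : List A) →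
            count p (x ∷ xs) ≡ indicator (p x) + count p xs
  count-∷ p x xs with p x
  ... | true  = refl
  ... | false = refl

  count-as-sum : (p : A → Bool) (xs : List A) → count p xs ≡ sum (map (indicator ∘ p) xs)
  count-as-sum p []       = refl
  count-as-sum p (x ∷ xs) = trans (count-∷ p x xs) (cong (indicator (p x) +_) (count-as-sum p xs))

  count-mono : (p q : A → Bool) → (∀ x → T (p x) → T (q x)) → ∀ xs → count p xs ≤ count q xs
  count-mono p q p⇒q xs = length-mono-≤ (filter⁺ (T? ∘ p) (T? ∘ q) (λ { refl → p⇒q _ }) (⊆-refl {x = xs}))

  count-cong : (p q : A → Bool) → (∀ x → p x ≡ q x) → ∀ xs → count p xs ≡ count q xs
  count-cong p q p≡q xs = ≤-antisym (count-mono p q (λ x → subst T (p≡q x)) xs)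
                                    (count-mono q p (λ x → subst T (sym (p≡q x))) xs)

count-false : ∀ {A : Set} (xs : List A) → count (λ _ → false) xs ≡ 0
count-false []       = refl
count-false (x ∷ xs) = count-false xs

count-map : ∀ {A B : Set} (p : B → Bool) (f : A → B) (xs : List A) →
            count p (map f xs) ≡ count (p ∘ f) xs
count-map p f []       = refl
count-map p f (x ∷ xs) = begin
  count p (map f (x ∷ xs))                ≡⟨ count-∷ p (f x) (map f xs) ⟩
  indicator (p (f x)) + count p (map f xs) ≡⟨ cong (indicator (p (f x)) +_) (count-map p f xs) ⟩
  indicator (p (f x)) + count (p ∘ f) xs  ≡⟨ count-∷ (p ∘ f) x xs ⟨
  count (p ∘ f) (x ∷ xs)                  ∎
  where open ≡-Reasoning

module _ {X : Set} where

  sum-zeros : (xs : List X) → sum (map (λ _ → 0) xs) ≡ 0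
  sum-zeros []       = refl
  sum-zeros (x ∷ xs) = sum-zeros xs

  sum-map-+ : (f g : X → ℕ) (xs : List X) →
              sum (map (λ x → f x + g x) xs) ≡ sum (map f xs) + sum (map g xs)
  sum-map-+ f g []       = refl
  sum-map-+ f g (x ∷ xs) = trans (cong (f x + g x +_) (sum-map-+ f g xs))
                                 (interchange (f x) (g x) (sum (map f xs)) (sum (map g xs)))

  length*≤sum : ∀ {N} (f : X → ℕ) (xs : List X) → All (λ x → N ≤ f x) xs →
                length xs * N ≤ sum (map f xs)
  length*≤sum f []       []           = z≤n
  length*≤sum f (x ∷ xs) (N≤fx ∷ N≤f) = +-mono-≤ N≤fx (length*≤sum f xs N≤f)

  double-counting : ∀ {A : Set} (R : X → A → Bool) (P : A → Bool) (xs : List X) →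
                    (∀ a → count (λ x → R x a) xs ≤ indicator (P a)) →
                    ∀ as → sum (map (λ x → count (R x) as) xs) ≤ count P as
  double-counting R P xs bound []       = ≤-reflexive (sum-zeros xs)
  double-counting R P xs bound (a ∷ as) = begin
    sum (map (λ x → count (R x) (a ∷ as)) xs)
      ≡⟨ cong sum (map-cong (λ x → count-∷ (R x) a as) xs) ⟩
    sum (map (λ x → indicator (R x a) + count (R x) as) xs)
      ≡⟨ sum-map-+ (λ x → indicator (R x a)) (λ x → count (R x) as) xs ⟩
    sum (map (λ x → indicator (R x a)) xs) + sum (map (λ x → count (R x) as) xs)
      ≡⟨ cong (_+ _) (sym (count-as-sum (λ x → R x a) xs)) ⟩
    count (λ x → R x a) xs + sum (map (λ x → count (R x) as) xs)
      ≤⟨ +-mono-≤ (bound a) (double-counting R P xs bound as) ⟩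
    indicator (P a) + count P as
      ≡⟨ sym (count-∷ P a as) ⟩
    count P (a ∷ as) ∎
    where open ≤-Reasoning

module _ {ℓ} (S : Setoid 0ℓ ℓ) where

  open Setoid S using (_≈_) renaming (Carrier to A; sym to ≈-sym; trans to ≈-trans)
  open SetoidMembership S using () renaming (_∈_ to _∈ₛ_)
  open SetoidUnique S using (Unique)

  ∈-─ : ∀ {x z ys} (x∈ys : x ∈ₛ ys) → z ∈ₛ ys → ¬ x ≈ z → z ∈ₛ (ys ─ x∈ys)
  ∈-─ (here x≈y)  (here z≈y)  x≉z = ⊥-elim (x≉z (≈-trans x≈y (≈-sym z≈y)))
  ∈-─ (here _)    (there z∈ys) _  = z∈ys
  ∈-─ (there _)   (here z≈y)   _  = here z≈y
  ∈-─ (there x∈ys) (there z∈ys) x≉z = there (∈-─ x∈ys z∈ys x≉z)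

  pigeonhole : ∀ {xs} ys → Unique xs → All (_∈ₛ ys) xs → length xs ≤ length ys
  pigeonhole ys [] [] = z≤n
  pigeonhole {x ∷ xs} ys (x≉xs ∷ xs!) (x∈ys ∷ xs⊆ys) = begin
    suc (length xs)           ≤⟨ s≤s (pigeonhole (ys ─ x∈ys) xs!
                                       (All.zipWith (λ (x≉z , z∈ys) → ∈-─ x∈ys z∈ys x≉z) (x≉xs , xs⊆ys))) ⟩
    suc (length (ys ─ x∈ys))  ≡⟨ sym (length-removeAt′ ys (index x∈ys)) ⟩
    length ys                 ∎
    where open ≤-Reasoning

  count-injection : (L : List A) → Unique L → (∀ a → a ∈ₛ L) →
                    (p q : A → Bool) → (∀ {a b} → a ≈ b → T (q a) → T (q b)) →
                    (h : A → A) → (∀ {a b} → h a ≈ h b → a ≈ b) →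
                    (∀ a → T (p a) → T (q (h a))) → count p L ≤ count q L
  count-injection L L! L-complete p q q-resp h h-inj p⇒qh =
    subst (_≤ count q L) (length-map h (filterᵇ p L))
      (pigeonhole (filterᵇ q L) (SetoidUniqueₚ.map⁺ S S h-inj (SetoidUniqueₚ.filter⁺ S (T? ∘ p) L!))
        (All.map⁺ (All.map (λ {a} pa → SetoidMembershipₚ.∈-filter⁺ S (T? ∘ q) q-resp (L-complete (h a)) (p⇒qh a pa))
                           (all-filter (T? ∘ p) L))))

any-with-all : ∀ {A : Set} {ℓ ℓ'} {P : A → Set ℓ} {Q : A → Set ℓ'} {xs} →
               Any P xs → All Q xs → Any (λ x → P x × Q x) xs
any-with-all (here Px)   (Qx ∷ _)  = here (Px , Qx)
any-with-all (there Pxs) (_ ∷ Qxs) = there (any-with-all Pxs Qxs)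

map-unique-on : ∀ {A B : Set} {ℓ} {Q : A → Set ℓ} (f : A → B) →
                (∀ {x y} → Q x → Q y → f x ≡ f y → x ≡ y) →
                ∀ {xs} → Uniqueₚ xs → All Q xs → Uniqueₚ (map f xs)
map-unique-on f f-inj []           []         = []
map-unique-on f f-inj (x≢xs ∷ xs!) (Qx ∷ Qxs) =
  All.map⁺ (All.zipWith (λ (x≢y , Qy) fx≡fy → x≢y (f-inj Qx Qy fx≡fy)) (x≢xs , Qxs))
  ∷ map-unique-on f f-inj xs! Qxs

module _ {A : Set} where

  count-∘-involution : (L : List A) → Uniqueₚ L → (∀ a → a ∈ₚ L) →
                       (p : A → Bool) (h : A → A) → Involutive _≡_ h →
                       count (p ∘ h) L ≡ count p L
  count-∘-involution L L! L-complete p h h-inv = ≤-antisym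
    (count-injection (setoid A) L L! L-complete (p ∘ h) p (subst (T ∘ p)) h h-inj (λ a → id))
    (count-injection (setoid A) L L! L-complete p (p ∘ h) (subst (T ∘ p ∘ h)) h h-inj
      (λ a pa → subst (T ∘ p) (sym (h-inv a)) pa))
    where
    h-inj : ∀ {a b} → h a ≡ h b → a ≡ b
    h-inj {a} {b} ha≡hb = trans (sym (h-inv a)) (trans (cong h ha≡hb) (h-inv b))

∈-allSubsets : ∀ {n} (S : Subset n) → S ∈ₚ allSubsets n
∈-allSubsets {zero}  []          = here refl
∈-allSubsets {suc n} (false ∷ S) = ∈-++⁺ˡ (∈-map⁺ (false ∷_) (∈-allSubsets S))
∈-allSubsets {suc n} (true ∷ S)  = ∈-++⁺ʳ (map (false ∷_) (allSubsets n)) (∈-map⁺ (true ∷_) (∈-allSubsets S))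

allSubsets-unique : ∀ n → Uniqueₚ (allSubsets n)
allSubsets-unique zero    = [] ∷ []
allSubsets-unique (suc n) =
  ++⁺ (map⁺ ∷-injectiveʳ (allSubsets-unique n)) (map⁺ ∷-injectiveʳ (allSubsets-unique n)) disjoint
  where
  disjoint : Disjoint (map (false ∷_) (allSubsets n)) (map (true ∷_) (allSubsets n))
  disjoint (S∈false , S∈true) with ∈-map⁻ (false ∷_) S∈false | ∈-map⁻ (true ∷_) S∈true
  ... | _ , _ , refl | _ , _ , ()

card-tabulate : ∀ {B : Set} {n} (S : Subset n) (f : Fin n → B) (p : B → Bool) →
                (∀ i → p (f i) ≡ lookup S i) → count p (tabulate f) ≡ ∣ S ∣
card-tabulate []      f p p∘f≡S = refl
card-tabulate (b ∷ S) f p p∘f≡S = begin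
  count p (tabulate f)                    ≡⟨ count-∷ p (f zero) (tabulate (f ∘ suc)) ⟩
  indicator (p (f zero)) + count p (tabulate (f ∘ suc))
    ≡⟨ cong₂ _+_ (cong indicator (p∘f≡S zero)) (card-tabulate S (f ∘ suc) p (p∘f≡S ∘ suc)) ⟩
  indicator b + ∣ S ∣                     ≡⟨ indicator-∷ b ⟩
  ∣ b ∷ S ∣                               ∎
  where
  open ≡-Reasoning
  indicator-∷ : ∀ b → indicator b + ∣ S ∣ ≡ ∣ b ∷ S ∣
  indicator-∷ true  = refl
  indicator-∷ false = refl

∣∣-as-count : ∀ {n} (S : Subset n) → ∣ S ∣ ≡ count (lookup S) (allFin n)
∣∣-as-count S = sym (card-tabulate S id (lookup S) (λ i → refl))

y∉p-y : ∀ {n} (p : Subset n) (y : Fin n) → y ∉ p - y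
y∉p-y (true  ∷ p) zero    ()
y∉p-y (false ∷ p) zero    ()
y∉p-y (_     ∷ p) (suc y) (Vec.there y∈p-y) = y∉p-y p y y∈p-y

∣p-x∣+1 : ∀ {n} {p : Subset n} {x} → x ∈ p → suc ∣ p - x ∣ ≡ ∣ p ∣
∣p-x∣+1 {p = true ∷ p}  Vec.here          = cong (suc ∘ ∣_∣) (p─⊥≡p p)
∣p-x∣+1 {p = true ∷ p}  (Vec.there x∈p)   = cong suc (∣p-x∣+1 x∈p)
∣p-x∣+1 {p = false ∷ p} (Vec.there x∈p)   = ∣p-x∣+1 x∈p

∣⁅x⁆∪p∣ : ∀ {n} {x : Fin n} {p : Subset n} → x ∉ p → ∣ ⁅ x ⁆ ∪ p ∣ ≡ suc ∣ p ∣
∣⁅x⁆∪p∣ {x = zero}  {true  ∷ p} x∉p = ⊥-elim (x∉p Vec.here)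
∣⁅x⁆∪p∣ {x = zero}  {false ∷ p} x∉p = cong (suc ∘ ∣_∣) (∪-identityˡ p)
∣⁅x⁆∪p∣ {x = suc x} {true  ∷ p} x∉p = cong suc (∣⁅x⁆∪p∣ (x∉p ∘ Vec.there))
∣⁅x⁆∪p∣ {x = suc x} {false ∷ p} x∉p = ∣⁅x⁆∪p∣ (x∉p ∘ Vec.there)

∣p∪q∣≤∣p∣+∣q∣ : ∀ {n} (p q : Subset n) → ∣ p ∪ q ∣ ≤ ∣ p ∣ + ∣ q ∣
∣p∪q∣≤∣p∣+∣q∣ []          []          = z≤n
∣p∪q∣≤∣p∣+∣q∣ (true  ∷ p) (true  ∷ q) = s≤s (≤-trans (∣p∪q∣≤∣p∣+∣q∣ p q) (+-monoʳ-≤ ∣ p ∣ (n≤1+n ∣ q ∣)))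
∣p∪q∣≤∣p∣+∣q∣ (true  ∷ p) (false ∷ q) = s≤s (∣p∪q∣≤∣p∣+∣q∣ p q)
∣p∪q∣≤∣p∣+∣q∣ (false ∷ p) (true  ∷ q) = ≤-trans (s≤s (∣p∪q∣≤∣p∣+∣q∣ p q)) (≤-reflexive (sym (+-suc ∣ p ∣ ∣ q ∣)))
∣p∪q∣≤∣p∣+∣q∣ (false ∷ p) (false ∷ q) = ∣p∪q∣≤∣p∣+∣q∣ p q

nonempty-of-size : ∀ {n k} {p : Subset n} → ∣ p ∣ ≡ suc k → Nonempty p
nonempty-of-size {n} {p = p} ∣p∣≡1+k with nonempty? p
... | yes p≠∅ = p≠∅
... | no  p=∅ with () ← trans (sym (∣⊥∣≡0 n)) (trans (cong ∣_∣ (sym (Empty-unique p=∅))) ∣p∣≡1+k)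

∈-difference : ∀ {n} {p q : Subset n} → ∣ p ∣ ≡ ∣ q ∣ → p ≢ q → ∃ λ b → b ∈ q × b ∉ p
∈-difference {p = p} {q} ∣p∣≡∣q∣ p≢q with any? (λ i → (i ∈? q) ×-dec ¬? (i ∈? p))
... | yes b∈q-p = b∈q-p
... | no  no-point-of-q-outside-p = ⊥-elim (p≢q (⊆-antisym p⊆q q⊆p))
  where
  q⊆p : q ⊆ p
  q⊆p {i} i∈q with i ∈? p
  ... | yes i∈p = i∈p
  ... | no  i∉p = ⊥-elim (no-point-of-q-outside-p (i , i∈q , i∉p))
  p⊆q : p ⊆ q
  p⊆q {i} i∈p with i ∈? q
  ... | yes i∈q = i∈q
  ... | no  i∉q = ⊥-elim (<-irrefl (sym ∣p∣≡∣q∣) (p⊂q⇒∣p∣<∣q∣ (q⊆p , i , i∈p , i∉q)))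

outside : ∀ {n} → Subset n → List (Fin n)
outside {n} K = filterᵇ (lookup (∁ K)) (allFin n)

module _ {n} (K : Subset n) where

  outside-unique : Uniqueₚ (outside K)
  outside-unique = Uniqueₚ-filter⁺ (T? ∘ lookup (∁ K)) (allFin⁺ n)

  ∉-outside : All (_∉ K) (outside K)
  ∉-outside = All.map (λ i∈∁K → x∈∁p⇒x∉p (lookup⇒[]= _ (∁ K) (Equivalence.to T-≡ i∈∁K)))
                      (all-filter (T? ∘ lookup (∁ K)) (allFin n))

  length-outside : length (outside K) ≡ n ∸ ∣ K ∣
  length-outside = trans (sym (∣∣-as-count (∁ K))) (∣∁p∣≡n∸∣p∣ K)

act : ∀ {n} → (Fin n → Fin n) → Subset n → Subset n
act π S = Vec.tabulate (lookup S ∘ π)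

module _ {n} (π : Fin n → Fin n) where

  lookup-act : ∀ S i → lookup (act π S) i ≡ lookup S (π i)
  lookup-act S = lookup∘tabulate (lookup S ∘ π)

  ∈-act⁺ : ∀ {S i} → π i ∈ S → i ∈ act π S
  ∈-act⁺ {S} {i} πi∈S = lookup⇒[]= i (act π S) (trans (lookup-act S i) ([]=⇒lookup πi∈S))

  ∈-act⁻ : ∀ {S i} → i ∈ act π S → π i ∈ S
  ∈-act⁻ {S} {i} i∈πS = lookup⇒[]= (π i) S (trans (sym (lookup-act S i)) ([]=⇒lookup i∈πS))

  ⊆-act : ∀ {S S'} → S ⊆ S' → act π S ⊆ act π S'
  ⊆-act S⊆S' = ∈-act⁺ ∘ S⊆S' ∘ ∈-act⁻

  module _ (π-inv : Involutive _≡_ π) where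

    act-involutive : Involutive _≡_ (act π)
    act-involutive S = ⊆-antisym (λ i∈ → subst (_∈ S) (π-inv _) (∈-act⁻ (∈-act⁻ i∈)))
                                 (λ i∈S → ∈-act⁺ (∈-act⁺ (subst (_∈ S) (sym (π-inv _)) i∈S)))

    ∣act∣ : ∀ S → ∣ act π S ∣ ≡ ∣ S ∣
    ∣act∣ S = begin
      ∣ act π S ∣                            ≡⟨ ∣∣-as-count (act π S) ⟩
      count (lookup (act π S)) (allFin n)    ≡⟨ count-cong _ _ (lookup-act S) (allFin n) ⟩
      count (lookup S ∘ π) (allFin n)        ≡⟨ count-∘-involution (allFin n) (allFin⁺ n) ∈-allFin (lookup S) π π-inv ⟩
      count (lookup S) (allFin n)            ≡⟨ ∣∣-as-count S ⟨
      ∣ S ∣                                  ∎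
      where open ≡-Reasoning

    ⊆?-act : ∀ S S' → ⌊ S ⊆? S' ⌋ ≡ ⌊ act π S ⊆? act π S' ⌋
    ⊆?-act S S' = trans (isYes≗does (S ⊆? S'))
      (trans (does-⇔ (mk⇔ ⊆-act (λ πS⊆πS' → subst₂ _⊆_ (act-involutive S) (act-involutive S') (⊆-act πS⊆πS')))
                      (S ⊆? S') (act π S ⊆? act π S'))
             (sym (isYes≗does (act π S ⊆? act π S'))))

module _ {n} (i j : Fin n) where

  transpose-ˡ : transpose i j i ≡ j
  transpose-ˡ rewrite dec-true (i ≟ i) refl = refl

  transpose-ʳ : transpose i j j ≡ i
  transpose-ʳ with j ≟ i
  ... | yes j≡i = j≡i
  ... | no  _   rewrite dec-true (j ≟ j) refl = refl

  transpose-other : ∀ {k} → k ≢ i → k ≢ j → transpose i j k ≡ k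
  transpose-other {k} k≢i k≢j rewrite dec-false (k ≟ i) k≢i | dec-false (k ≟ j) k≢j = refl

  transpose-involutive : Involutive _≡_ (transpose i j)
  transpose-involutive k = by-cases (k ≟ i) (k ≟ j)
    where
    by-cases : Dec (k ≡ i) → Dec (k ≡ j) → transpose i j (transpose i j k) ≡ k
    by-cases (yes k≡i) _         rewrite k≡i = trans (cong (transpose i j) transpose-ˡ) transpose-ʳ
    by-cases (no _)    (yes k≡j) rewrite k≡j = trans (cong (transpose i j) transpose-ʳ) transpose-ˡ
    by-cases (no k≢i)  (no k≢j)  = trans (cong (transpose i j) (transpose-other k≢i k≢j)) (transpose-other k≢i k≢j)

act-transpose-outside : ∀ {n} {A : Subset n} {b x : Fin n} → b ∉ A → x ∉ A → act (transpose b x) A ≡ A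
act-transpose-outside {A = A} {b} {x} b∉A x∉A = ⊆-antisym
  (λ {i} i∈tA → let t-i∈A = ∈-act⁻ (transpose b x) i∈tA in
                subst (_∈ A) (trans (sym (fixes t-i∈A)) (transpose-involutive b x i)) t-i∈A)
  (λ i∈A → ∈-act⁺ (transpose b x) (subst (_∈ A) (sym (fixes i∈A)) i∈A))
  where
  fixes : ∀ {i} → i ∈ A → transpose b x i ≡ i
  fixes i∈A = transpose-other b x (λ { refl → b∉A i∈A }) (λ { refl → x∉A i∈A })

FamilySetoid : ℕ → Setoid 0ℓ 0ℓ
FamilySetoid n = Subset n →-setoid Bool

_≈F_ : ∀ {n} → Family n → Family n → Set
F ≈F G = Setoid._≈_ (FamilySetoid _) F G

module _ {n : ℕ} where

  open SetoidMembership (FamilySetoid n) using () renaming (_∈_ to _∈F_)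
  open SetoidUnique (FamilySetoid n) using () renaming (Unique to UniqueF)

  insert-here : ∀ A (F : Family n) → insert A F A ≡ true
  insert-here A F rewrite dec-true (A ≟ˢ A) refl = refl

  insert-there : ∀ {A B} (F : Family n) → B ≢ A → insert A F B ≡ F B
  insert-there {A} {B} F B≢A rewrite dec-false (B ≟ˢ A) B≢A = refl

  insert-cancel : ∀ {A} {G H : Family n} → G A ≡ false → H A ≡ false →
                  insert A G ≈F insert A H → G ≈F H
  insert-cancel {A} {G} {H} GA HA eq B with B ≟ˢ A
  ... | yes refl = trans GA (sym HA)
  ... | no  B≢A  = trans (sym (insert-there G B≢A)) (trans (eq B) (insert-there H B≢A))

  absent≉insert : ∀ {A} {G H : Family n} → G A ≡ false → ¬ G ≈F insert A H
  absent≉insert {A} {G} {H} GA eq with () ← trans (sym GA) (trans (eq A) (insert-here A H))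

  doubled : Subset n → List (Family n) → List (Family n)
  doubled A = concatMap (λ G → G ∷ insert A G ∷ [])

  module _ {A : Subset n} {ℓ} {P : Family n → Set ℓ} where

    All-doubled : ∀ {Gs} → All (λ G → P G × P (insert A G)) Gs → All P (doubled A Gs)
    All-doubled []                = []
    All-doubled ((PG , PAG) ∷ PGs) = PG ∷ PAG ∷ All-doubled PGs

    Any-doubled-ˡ : ∀ {Gs} → Any P Gs → Any P (doubled A Gs)
    Any-doubled-ˡ (here PG)   = here PG
    Any-doubled-ˡ (there PGs) = there (there (Any-doubled-ˡ PGs))

    Any-doubled-ʳ : ∀ {Gs} → Any (P ∘ insert A) Gs → Any P (doubled A Gs)
    Any-doubled-ʳ (here PAG)  = there (here PAG)
    Any-doubled-ʳ (there PGs) = there (there (Any-doubled-ʳ PGs))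

  doubled-unique : ∀ {A Gs} → UniqueF Gs → All (λ G → G A ≡ false) Gs → UniqueF (doubled A Gs)
  doubled-unique []               []          = []
  doubled-unique (G≉Gs ∷ Gs!) (GA ∷ GsA) =
    (absent≉insert GA ∷ All-doubled (All.zipWith (λ (G≉H , _) → G≉H , absent≉insert GA) (G≉Gs , GsA)))
    ∷ All-doubled (All.zipWith (λ (G≉H , HA) → (λ eq → absent≉insert HA (λ B → sym (eq B)))
                                             , (λ eq → G≉H (insert-cancel GA HA eq))) (G≉Gs , GsA))
    ∷ doubled-unique Gs! GsA

  familiesOver-vanish : ∀ Ls → All (λ G → ∀ B → B ∉ₚ Ls → G B ≡ false) (familiesOver Ls)
  familiesOver-vanish []       = (λ B _ → refl) ∷ []
  familiesOver-vanish (A ∷ As) = All-doubled (All.map extend (familiesOver-vanish As))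
    where
    extend : ∀ {G : Family n} → (∀ B → B ∉ₚ As → G B ≡ false) →
             (∀ B → B ∉ₚ A ∷ As → G B ≡ false) × (∀ B → B ∉ₚ A ∷ As → insert A G B ≡ false)
    extend {G} G-vanish = (λ B B∉ → G-vanish B (B∉ ∘ there))
                        , (λ B B∉ → trans (insert-there G (B∉ ∘ here)) (G-vanish B (B∉ ∘ there)))

  familiesOver-complete : ∀ {Ls} → Uniqueₚ Ls → (F : Family n) →
                          Any (λ G → ∀ B → B ∈ₚ Ls → F B ≡ G B) (familiesOver Ls)
  familiesOver-complete []                   F = here (λ B ())
  familiesOver-complete {A ∷ As} (A≢As ∷ As!) F with F A in FA
  ... | true  = Any-doubled-ʳ (Any.map add-A (familiesOver-complete As! F))
    where
    add-A : ∀ {G : Family n} → (∀ B → B ∈ₚ As → F B ≡ G B) → ∀ B → B ∈ₚ A ∷ As → F B ≡ insert A G B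
    add-A {G} agree B B∈ with B ≟ˢ A | B∈
    ... | yes refl | _          = FA
    ... | no  B≢A  | here B≡A   = ⊥-elim (B≢A B≡A)
    ... | no  B≢A  | there B∈As = agree B B∈As
  ... | false = Any-doubled-ˡ (Any.map keep (any-with-all (familiesOver-complete As! F) (familiesOver-vanish As)))
    where
    A∉As : A ∉ₚ As
    A∉As = Unique[x∷xs]⇒x∉xs (A≢As ∷ As!)
    keep : ∀ {G : Family n} → (∀ B → B ∈ₚ As → F B ≡ G B) × (∀ B → B ∉ₚ As → G B ≡ false) →
           ∀ B → B ∈ₚ A ∷ As → F B ≡ G B
    keep (agree , _)    B (there B∈As) = agree B B∈As
    keep (_ , G-vanish) B (here refl)  = trans FA (sym (G-vanish A A∉As))

  familiesOver-unique : ∀ {Ls} → Uniqueₚ Ls → UniqueF (familiesOver Ls)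
  familiesOver-unique []           = [] ∷ []
  familiesOver-unique {A ∷ As} (A≢As ∷ As!) =
    doubled-unique (familiesOver-unique As!)
      (All.map (λ G-vanish → G-vanish A (Unique[x∷xs]⇒x∉xs (A≢As ∷ As!))) (familiesOver-vanish As))

  ∈-allFamilies : (F : Family n) → F ∈F allFamilies n
  ∈-allFamilies F = Any.map (λ agree B → agree B (∈-allSubsets B))
                            (familiesOver-complete (allSubsets-unique n) F)

  allFamilies-unique : UniqueF (allFamilies n)
  allFamilies-unique = familiesOver-unique (allSubsets-unique n)

record IsSteiner (n d : ℕ) (F : Family n) : Set where
  field
    block-size   : ∀ B → T (F B) → ∣ B ∣ ≡ suc d
    unique-block : ∀ τ → ∣ τ ∣ ≡ d → #containing F τ ≡ 1

module _ {n : ℕ} where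

  allᵇ-allSubsets⁻ : (p : Subset n → Bool) → T (allᵇ p (allSubsets n)) → ∀ S → T (p S)
  allᵇ-allSubsets⁻ p all-p S = All.lookup (allᵇ⇒All p (allSubsets n) all-p) (∈-allSubsets S)
    where
    allᵇ⇒All : (p : Subset n → Bool) (L : List (Subset n)) → T (allᵇ p L) → All (T ∘ p) L
    allᵇ⇒All p []      _     = []
    allᵇ⇒All p (S ∷ L) all-p = proj₁ (T-∧⁻ all-p) ∷ allᵇ⇒All p L (proj₂ (T-∧⁻ all-p))

  allᵇ-allSubsets⁺ : (p : Subset n → Bool) → (∀ S → T (p S)) → T (allᵇ p (allSubsets n))
  allᵇ-allSubsets⁺ p p-holds = All⇒allᵇ (allSubsets n)
    where
    All⇒allᵇ : (L : List (Subset n)) → T (allᵇ p L)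
    All⇒allᵇ []      = _
    All⇒allᵇ (S ∷ L) = T-∧⁺ (p-holds S) (All⇒allᵇ L)

  if-else-true⁻ : ∀ c e → T (if c then e else true) → T c → T e
  if-else-true⁻ true e t _ = t

  if-else-true⁺ : ∀ c e → (T c → T e) → T (if c then e else true)
  if-else-true⁺ true  e c⇒e = c⇒e _
  if-else-true⁺ false e c⇒e = _

  isSteiner⇒IsSteiner : ∀ {d F} → T (isSteiner n d F) → IsSteiner n d F
  isSteiner⇒IsSteiner {d} {F} steiner = record
    { block-size   = λ B FB → ≡ᵇ⇒≡ ∣ B ∣ (suc d)
        (if-else-true⁻ (F B) _ (allᵇ-allSubsets⁻ _ (proj₁ (T-∧⁻ steiner)) B) FB)
    ; unique-block = λ τ ∣τ∣≡d → ≡ᵇ⇒≡ (#containing F τ) 1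
        (if-else-true⁻ _ _ (allᵇ-allSubsets⁻ _ (proj₂ (T-∧⁻ steiner)) τ) (≡⇒≡ᵇ ∣ τ ∣ d ∣τ∣≡d))
    }

  IsSteiner⇒isSteiner : ∀ {d F} → IsSteiner n d F → T (isSteiner n d F)
  IsSteiner⇒isSteiner {d} {F} steiner = T-∧⁺
    (allᵇ-allSubsets⁺ _ λ B → if-else-true⁺ (F B) _ λ FB → ≡⇒≡ᵇ ∣ B ∣ (suc d) (block-size B FB))
    (allᵇ-allSubsets⁺ _ λ τ → if-else-true⁺ _ _ λ ∣τ∣≡d →
      ≡⇒≡ᵇ (#containing F τ) 1 (unique-block τ (≡ᵇ⇒≡ ∣ τ ∣ d ∣τ∣≡d)))
    where open IsSteiner steiner

  IsSteiner-resp : ∀ {d} {F G : Family n} → F ≈F G → IsSteiner n d F → IsSteiner n d G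
  IsSteiner-resp {F = F} {G} F≈G steiner = record
    { block-size   = λ B GB → block-size B (subst T (sym (F≈G B)) GB)
    ; unique-block = λ τ ∣τ∣≡d → trans
        (count-cong _ _ (λ S → cong (_∧ ⌊ τ ⊆? S ⌋) (sym (F≈G S))) (allSubsets n))
        (unique-block τ ∣τ∣≡d)
    }
    where open IsSteiner steiner

relabel : ∀ {n} → (Fin n → Fin n) → Family n → Family n
relabel π F = F ∘ act π

module _ {n} (π : Fin n → Fin n) (π-inv : Involutive _≡_ π) where

  #containing-relabel : (F : Family n) (τ : Subset n) →
                        #containing (relabel π F) τ ≡ #containing F (act π τ)
  #containing-relabel F τ = begin
    count (λ S → F (act π S) ∧ ⌊ τ ⊆? S ⌋) (allSubsets n)
      ≡⟨ count-cong _ _ (λ S → cong (F (act π S) ∧_) (⊆?-act π π-inv τ S)) (allSubsets n) ⟩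
    count (contains-πτ ∘ act π) (allSubsets n)
      ≡⟨ count-∘-involution (allSubsets n) (allSubsets-unique n) ∈-allSubsets contains-πτ
                            (act π) (act-involutive π π-inv) ⟩
    count contains-πτ (allSubsets n) ∎
    where
    open ≡-Reasoning
    contains-πτ : Subset n → Bool
    contains-πτ S = F S ∧ ⌊ act π τ ⊆? S ⌋

  IsSteiner-relabel : ∀ {d F} → IsSteiner n d F → IsSteiner n d (relabel π F)
  IsSteiner-relabel {d} {F} steiner = record
    { block-size   = λ B FπB → trans (sym (∣act∣ π π-inv B)) (block-size (act π B) FπB)
    ; unique-block = λ τ ∣τ∣≡d → trans (#containing-relabel F τ)
                                       (unique-block (act π τ) (trans (∣act∣ π π-inv τ) ∣τ∣≡d))
    }
    where open IsSteiner steiner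

  relabel-injective : ∀ {F G} → relabel π F ≈F relabel π G → F ≈F G
  relabel-injective {F} {G} eq S =
    trans (cong F (sym (act-involutive π π-inv S)))
          (trans (eq (act π S)) (cong G (act-involutive π π-inv S)))

#SteinerWith : (n d : ℕ) → (Family n → Bool) → ℕ
#SteinerWith n d P = count (λ F → isSteiner n d F ∧ P F) (allFamilies n)

module _ {n d : ℕ} where

  at-most-one-block : ∀ {F} → IsSteiner n d F → ∀ {D} → ∣ D ∣ ≡ d →
                      (Bs : List (Subset n)) → Uniqueₚ Bs → All (D ⊆_) Bs → count F Bs ≤ 1
  at-most-one-block {F} steiner {D} ∣D∣≡d Bs Bs! D⊆Bs = begin
    count F Bs
      ≤⟨ pigeonhole (setoid (Subset n)) blocks-through-D
           (SetoidUniqueₚ.filter⁺ (setoid _) (T? ∘ F) Bs!)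
           (All.zipWith listed (all-filter (T? ∘ F) Bs , All.filter⁺ (T? ∘ F) D⊆Bs)) ⟩
    length blocks-through-D
      ≡⟨ IsSteiner.unique-block steiner D ∣D∣≡d ⟩
    1 ∎
    where
    open ≤-Reasoning
    blocks-through-D : List (Subset n)
    blocks-through-D = filterᵇ (λ B → F B ∧ ⌊ D ⊆? B ⌋) (allSubsets n)
    listed : ∀ {B} → T (F B) × D ⊆ B → B ∈ₚ blocks-through-D
    listed {B} (FB , D⊆B) = SetoidMembershipₚ.∈-filter⁺ (setoid _) (T? ∘ _) (subst (T ∘ _))
                              (∈-allSubsets B) (T-∧⁺ FB (fromWitness (λ {x} → D⊆B {x})))

  module _ (P : Family n → Bool) (P-resp : ∀ {F G} → F ≈F G → P F ≡ P G) where

    #SteinerWithBlock : Subset n → ℕ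
    #SteinerWithBlock B = #SteinerWith n d (λ F → P F ∧ F B)

    #SteinerWithBlock-relabel : ∀ π → (π-inv : Involutive _≡_ π) →
                                (∀ F → T (P F) → T (P (relabel π F))) →
                                ∀ B → #SteinerWithBlock B ≤ #SteinerWithBlock (act π B)
    #SteinerWithBlock-relabel π π-inv P-relabel B =
      count-injection (FamilySetoid n) (allFamilies n) allFamilies-unique ∈-allFamilies
        (λ F → isSteiner n d F ∧ P F ∧ F B) passes passes-resp
        (relabel π) (relabel-injective π π-inv) maps
      where
      passes : Family n → Bool
      passes F = isSteiner n d F ∧ P F ∧ F (act π B)
      passes-resp : ∀ {F G} → F ≈F G → T (passes F) → T (passes G)
      passes-resp {F} {G} F≈G t with (st , Pt) ← T-∧⁻ t with (PF , FπB) ← T-∧⁻ Pt =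
        T-∧⁺ (IsSteiner⇒isSteiner (IsSteiner-resp F≈G (isSteiner⇒IsSteiner st)))
             (T-∧⁺ (subst T (P-resp F≈G) PF) (subst T (F≈G (act π B)) FπB))
      maps : ∀ F → T (isSteiner n d F ∧ P F ∧ F B) → T (passes (relabel π F))
      maps F t with (st , Pt) ← T-∧⁻ t with (PF , FB) ← T-∧⁻ Pt =
        T-∧⁺ (IsSteiner⇒isSteiner (IsSteiner-relabel π π-inv (isSteiner⇒IsSteiner st)))
             (T-∧⁺ (P-relabel F PF) (subst (T ∘ F) (sym (act-involutive π π-inv B)) FB))

    -- Switching: let B be a (d+1)-set, b ∈ B, and X distinct points outside B
    -- such that each transposition (b x), x ∈ X, preserves P.  Exchanging b for
    -- x ∈ X yields |X| blocks, each in at least as many systems as B (symmetry),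
    -- all through the d-set B - b, so that no system contains two of them.
    module _ {B : Subset n} {b : Fin n} (b∈B : b ∈ B) (∣B∣≡1+d : ∣ B ∣ ≡ suc d) where

      switched : Fin n → Subset n
      switched x = act (transpose b x) B

      x∈switched : ∀ x → x ∈ switched x
      x∈switched x = ∈-act⁺ (transpose b x) (subst (_∈ B) (sym (transpose-ʳ b x)) b∈B)

      switched-injective : ∀ {x y} → x ∉ B → y ∉ B → switched x ≡ switched y → x ≡ y
      switched-injective {x} {y} x∉B y∉B eq with x ≟ y
      ... | yes x≡y = x≡y
      ... | no  x≢y = ⊥-elim (x∉B (subst (_∈ B) (transpose-other b y x≢b x≢y)
                                        (∈-act⁻ (transpose b y) (subst (x ∈_) eq (x∈switched x)))))
        where
        x≢b : x ≢ b
        x≢b refl = x∉B b∈B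

      B-b⊆switched : ∀ {x} → x ∉ B → B - b ⊆ switched x
      B-b⊆switched {x} x∉B {i} i∈B-b = ∈-act⁺ (transpose b x) (subst (_∈ B) (sym (transpose-other b x i≢b i≢x)) i∈B)
        where
        i∈B : i ∈ B
        i∈B = p─q⊆p B ⁅ b ⁆ i∈B-b
        i≢b : i ≢ b
        i≢b refl = y∉p-y B b i∈B-b
        i≢x : i ≢ x
        i≢x refl = x∉B i∈B

      switching : (X : List (Fin n)) → Uniqueₚ X → All (_∉ B) X →
                  All (λ x → ∀ F → T (P F) → T (P (relabel (transpose b x) F))) X →
                  length X * #SteinerWithBlock B ≤ #SteinerWith n d P
      switching X X! X∉B P-relabel = begin
        length X * #SteinerWithBlock B
          ≤⟨ length*≤sum (#SteinerWithBlock ∘ switched) X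
               (All.map (λ {x} P-rel → #SteinerWithBlock-relabel (transpose b x) (transpose-involutive b x) P-rel B)
                        P-relabel) ⟩
        sum (map (#SteinerWithBlock ∘ switched) X)
          ≤⟨ double-counting (λ x F → isSteiner n d F ∧ P F ∧ F (switched x)) (λ F → isSteiner n d F ∧ P F)
                             X per-system (allFamilies n) ⟩
        #SteinerWith n d P ∎
        where
        open ≤-Reasoning
        per-system : ∀ F → count (λ x → isSteiner n d F ∧ P F ∧ F (switched x)) X ≤ indicator (isSteiner n d F ∧ P F)
        per-system F with isSteiner n d F in st | P F
        ... | false | _     = ≤-reflexive (count-false X)
        ... | true  | false = ≤-reflexive (count-false X)
        ... | true  | true  = begin
          count (F ∘ switched) X    ≡⟨ count-map F switched X ⟨
          count F (map switched X)  ≤⟨ at-most-one-block (isSteiner⇒IsSteiner (subst T (sym st) _)) ∣B-b∣≡d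
                                         (map switched X) (map-unique-on switched switched-injective X! X∉B)
                                         (All.map⁺ (All.map B-b⊆switched X∉B)) ⟩
          1                         ∎
          where
          ∣B-b∣≡d : ∣ B - b ∣ ≡ d
          ∣B-b∣≡d = suc-injective (trans (∣p-x∣+1 b∈B) ∣B∣≡1+d)

module _ {n d : ℕ} where

  -- A fixed (d+1)-set A is a block of at most a 1/(n-d-1) fraction of the
  -- Steiner systems: switch with P = true, around any point of A.
  block-bound : ∀ {A} → ∣ A ∣ ≡ suc d → (n ∸ suc d) * #SteinerWith n d (λ F → F A) ≤ #Steiner n d
  block-bound {A} ∣A∣≡1+d with nonempty-of-size ∣A∣≡1+d
  ... | a , a∈A = begin
    (n ∸ suc d) * #SteinerWith n d (λ F → F A)
      ≡⟨ cong (λ k → (n ∸ k) * #SteinerWith n d (λ F → F A)) (sym ∣A∣≡1+d) ⟩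
    (n ∸ ∣ A ∣) * #SteinerWith n d (λ F → F A)
      ≡⟨ cong (_* #SteinerWith n d (λ F → F A)) (sym (length-outside A)) ⟩
    length (outside A) * #SteinerWith n d (λ F → F A)
      ≤⟨ switching (λ _ → true) (λ _ → refl) a∈A ∣A∣≡1+d (outside A) (outside-unique A) (∉-outside A)
                   (All.tabulate (λ _ _ _ → _)) ⟩
    #SteinerWith n d (λ _ → true)
      ≡⟨ count-cong _ _ (λ F → ∧-identityʳ (isSteiner n d F)) (allFamilies n) ⟩
    #Steiner n d ∎
    where open ≤-Reasoning

  -- For (d+1)-sets A, B with a point b ∈ B outside A, at most a 1/(n-2d-2)
  -- fraction of the systems containing A also contain B: switch B around b,
  -- with P = (A is a block), using points outside A ∪ B, whose transpositions fix A.
  pair-bound : ∀ {A B b} → ∣ A ∣ ≡ suc d → ∣ B ∣ ≡ suc d → b ∈ B → b ∉ A →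
               (n ∸ (suc d + suc d)) * #SteinerWith n d (λ F → F A ∧ F B) ≤ #SteinerWith n d (λ F → F A)
  pair-bound {A} {B} {b} ∣A∣≡1+d ∣B∣≡1+d b∈B b∉A = begin
    (n ∸ (suc d + suc d)) * #SteinerWith n d (λ F → F A ∧ F B)
      ≤⟨ *-monoˡ-≤ (#SteinerWith n d (λ F → F A ∧ F B))
           (∸-monoʳ-≤ n (subst (∣ A ∪ B ∣ ≤_) (cong₂ _+_ ∣A∣≡1+d ∣B∣≡1+d) (∣p∪q∣≤∣p∣+∣q∣ A B))) ⟩
    (n ∸ ∣ A ∪ B ∣) * #SteinerWith n d (λ F → F A ∧ F B)
      ≡⟨ cong (_* #SteinerWith n d (λ F → F A ∧ F B)) (sym (length-outside (A ∪ B))) ⟩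
    length (outside (A ∪ B)) * #SteinerWith n d (λ F → F A ∧ F B)
      ≤⟨ switching (λ F → F A) (λ F≈G → F≈G A) b∈B ∣B∣≡1+d (outside (A ∪ B)) (outside-unique (A ∪ B))
                   (All.map (λ x∉A∪B → x∉A∪B ∘ q⊆p∪q A B) (∉-outside (A ∪ B)))
                   (All.map (λ x∉A∪B F FA → subst (T ∘ F) (sym (act-transpose-outside b∉A (x∉A∪B ∘ p⊆p∪q B))) FA)
                            (∉-outside (A ∪ B))) ⟩
    #SteinerWith n d (λ F → F A) ∎
    where open ≤-Reasoning

-- Arithmetic core: if (n-m)·N ≤ M, (n-m)·M ≤ S and N ≤ S, then N·n² ≤ 4m²·S.
-- For n ≤ 2m use N ≤ S; otherwise k = n-m ≥ m and n ≤ 2k, so N·n² ≤ 4k²N ≤ 4S.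
module _ where

  open +-*-Solver using (solve; _:+_; _:*_; _:=_; con)

  N·n²≤4·j·j·N : ∀ {n} j N → n ≤ j + j → N * n ^ 2 ≤ 4 * (j * (j * N))
  N·n²≤4·j·j·N {n} j N n≤2j = begin
    N * (n * (n * 1))              ≤⟨ *-monoʳ-≤ N (*-mono-≤ n≤2j (*-monoˡ-≤ 1 n≤2j)) ⟩
    N * ((j + j) * ((j + j) * 1))  ≡⟨ solve 2 (λ N j → N :* ((j :+ j) :* ((j :+ j) :* con 1))
                                                   := con 4 :* (j :* (j :* N))) refl N j ⟩
    4 * (j * (j * N))              ∎
    where open ≤-Reasoning

  quadratic-bound : ∀ m n {N M S} → 1 ≤ m → (n ∸ m) * N ≤ M → (n ∸ m) * M ≤ S → N ≤ S →
                    N * n ^ 2 ≤ 4 * (m * m) * S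
  quadratic-bound m n {N} {M} {S} 1≤m kN≤M kM≤S N≤S with n ≤? m + m
  ... | yes n≤2m = begin
    N * n ^ 2            ≤⟨ N·n²≤4·j·j·N m N n≤2m ⟩
    4 * (m * (m * N))    ≤⟨ *-monoʳ-≤ 4 (*-monoʳ-≤ m (*-monoʳ-≤ m N≤S)) ⟩
    4 * (m * (m * S))    ≡⟨ solve 2 (λ m S → con 4 :* (m :* (m :* S)) := con 4 :* (m :* m) :* S) refl m S ⟩
    4 * (m * m) * S      ∎
    where open ≤-Reasoning
  ... | no  n≰2m = begin
    N * n ^ 2            ≤⟨ N·n²≤4·j·j·N k N n≤2k ⟩
    4 * (k * (k * N))    ≤⟨ *-monoʳ-≤ 4 (*-monoʳ-≤ k kN≤M) ⟩
    4 * (k * M)          ≤⟨ *-monoʳ-≤ 4 kM≤S ⟩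
    4 * S                ≤⟨ *-monoˡ-≤ S (*-monoʳ-≤ 4 (*-mono-≤ 1≤m 1≤m)) ⟩
    4 * (m * m) * S      ∎
    where
    open ≤-Reasoning
    k = n ∸ m
    2m<n : m + m < n
    2m<n = ≰⇒> n≰2m
    m+k≡n : m + k ≡ n
    m+k≡n = m+[n∸m]≡n (≤-trans (m≤m+n m m) (<⇒≤ 2m<n))
    n≤2k : n ≤ k + k
    n≤2k = ≤-trans (≤-reflexive (sym m+k≡n))
                   (+-monoˡ-≤ k (+-cancelˡ-≤ m m k (≤-trans (<⇒≤ 2m<n) (≤-reflexive (sym m+k≡n)))))

-- Proposition 3.8.  With A = {v} ∪ σ and B = {v} ∪ σ', both (d+1)-sets, and
-- b ∈ σ' \ σ, we have b ∈ B \ A.  The pair and block bounds give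
-- (n-m)·#{A,B ∈ S} ≤ #{A ∈ S} and (n-m)·#{A ∈ S} ≤ #S for m = 2(d+1),
-- whence #{A,B ∈ S}·n² ≤ 4m²·#S.
proposition3p8 : (d : ℕ) → Σ ℕ λ C → 0 < C ×
    ((n : ℕ) → 0 < #Steiner n d →
      (σ σ' : Subset n) → ∣ σ ∣ ≡ d → ∣ σ' ∣ ≡ d → σ ≢ σ' →
      (v : Fin n) → v ∉ σ ∪ σ' →
      #SteinerBoth n d (⁅ v ⁆ ∪ σ) (⁅ v ⁆ ∪ σ') * n ^ 2 ≤ C * #Steiner n d)
proposition3p8 d = 4 * (m * m) , s≤s z≤n , bound
  where
  m = suc d + suc d
  bound : (n : ℕ) → 0 < #Steiner n d →
          (σ σ' : Subset n) → ∣ σ ∣ ≡ d → ∣ σ' ∣ ≡ d → σ ≢ σ' →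
          (v : Fin n) → v ∉ σ ∪ σ' →
          #SteinerBoth n d (⁅ v ⁆ ∪ σ) (⁅ v ⁆ ∪ σ') * n ^ 2 ≤ 4 * (m * m) * #Steiner n d
  bound n _ σ σ' ∣σ∣≡d ∣σ'∣≡d σ≢σ' v v∉σ∪σ' with ∈-difference (trans ∣σ∣≡d (sym ∣σ'∣≡d)) σ≢σ'
  ... | b , b∈σ' , b∉σ =
    quadratic-bound m n (s≤s z≤n)
      (pair-bound {n} {d} {A} {B} ∣A∣≡1+d ∣B∣≡1+d (q⊆p∪q ⁅ v ⁆ σ' b∈σ') b∉A)
      (≤-trans (*-monoˡ-≤ (#SteinerWith n d (λ F → F A)) (∸-monoʳ-≤ n (m≤m+n (suc d) (suc d))))
               (block-bound {n} {d} {A} ∣A∣≡1+d))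
      (count-mono _ _ (λ F → proj₁ ∘ T-∧⁻) (allFamilies n))
    where
    A = ⁅ v ⁆ ∪ σ
    B = ⁅ v ⁆ ∪ σ'
    ∣A∣≡1+d : ∣ A ∣ ≡ suc d
    ∣A∣≡1+d = trans (∣⁅x⁆∪p∣ (v∉σ∪σ' ∘ p⊆p∪q σ')) (cong suc ∣σ∣≡d)
    ∣B∣≡1+d : ∣ B ∣ ≡ suc d
    ∣B∣≡1+d = trans (∣⁅x⁆∪p∣ (v∉σ∪σ' ∘ q⊆p∪q σ σ')) (cong suc ∣σ'∣≡d)
    b∉A : b ∉ A
    b∉A b∈A with x∈p∪q⁻ ⁅ v ⁆ σ b∈A
    ... | inj₁ b∈⁅v⁆ = v∉σ∪σ' (q⊆p∪q σ σ' (subst (_∈ σ') (x∈⁅y⁆⇒x≡y v b∈⁅v⁆) b∈σ'))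
    ... | inj₂ b∈σ   = b∉σ b∈σ
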